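{- Let $j_3$ be the marked mesh pattern $(43251;\ \text{shaded } \{(1,4),(1,5),(2,4),(2,5)\};\ \text{marked } \{(2,3)\})$ and let $W_2$ be the mesh pattern $(3241;\ \text{shaded } \{(1,4)\})$. If $\pi$ is a permutation and $i_1<\dots<i_5$ is an occurrence of $j_3$ in $\pi$, then the four entries $\pi(i_1),\pi(i_2),\pi(i_3),\pi(i_5)$ (those playing the roles of the pattern values $4,3,2,1$), at their positions in $S(\pi)$, form an occurrence of $W_2$ in $S(\pi)$.
   Context: Permutations are written in one-line notation. The stack-sort operator $S$ is defined by $S(\varepsilon)=\varepsilon$ and, if $\pi=\alpha\, m\,\beta$ with $m$ the largest entry, $S(\pi)=S(\alpha)S(\beta)m$. An occurrence of a classical pattern $p\in S_k$ in $\pi\in S_n$ is a sequence of indices $i_1<\dots<i_k$ with $\pi(i_a)<\pi(i_b)\iff p(a)<p(b)$. For an occurrence put $i_0=0$, $i_{k+1}=n+1$, let $v_0=0$, $v_1<\dots<v_k$ the occurrence values sorted, $v_{k+1}=n+1$; box $(a,b)\in\{0,\dots,k\}^2$ corresponds to the entries $\pi(t)$ with $i_a<t<i_{a+1}$ and $v_b<\pi(t)<v_{b+1}$. In the notation $(p;\ \text{shaded } R;\ \text{marked } M)$, an occurrence of the pattern is an occurrence of $p$ such that every box in $R$ corresponds to the empty set and the union of the entries corresponding to the boxes in $M$ contains at least one entry. -}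

module Defs where

open import Data.Nat using (ℕ; zero; suc; _+_; _<_; _≤_; _⊔_; _≟_)
open import Data.Nat.Properties using (≤-decTotalOrder)
open import Data.List using (List; []; _∷_; _++_; [_]; length; map; upTo; foldr)
open import Data.List.Sort.InsertionSort ≤-decTotalOrder using (sort)
open import Data.List.Membership.Propositional using (_∈_)
open import Data.List.Relation.Binary.Permutation.Propositional using (_↭_)
open import Data.Product using (_×_; _,_; Σ; ∃)
open import Data.Empty using (⊥)
open import Data.Unit using (⊤)
open import Relation.Nullary using (¬_; yes; no)
open import Function.Bundles using (_⇔_)
open import Relation.Binary.PropositionalEquality using (_≡_)

IsPerm : List ℕ → Set
IsPerm π = π ↭ map suc (upTo (length π))

nthD : ℕ → List ℕ → ℕ → ℕ
nthD d []       _       = d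
nthD d (x ∷ xs) zero    = x
nthD d (x ∷ xs) (suc i) = nthD d xs i

-- π(t) for 1-based positions t (π(0) is a dummy 0, never used for 1 ≤ t ≤ n)
val : List ℕ → ℕ → ℕ
val π zero    = 0
val π (suc t) = nthD 0 π t

maxL : List ℕ → ℕ
maxL = foldr _⊔_ 0

splitAt : ℕ → List ℕ → List ℕ × List ℕ
splitAt m [] = [] , []
splitAt m (x ∷ xs) with x ≟ m
... | yes _ = [] , xs
... | no  _ with splitAt m xs
...   | (α , β) = x ∷ α , β

stackSortF : ℕ → List ℕ → List ℕ
stackSortF zero    _  = []
stackSortF (suc f) [] = []
stackSortF (suc f) (x ∷ xs) with splitAt (maxL (x ∷ xs)) (x ∷ xs)
... | (α , β) = stackSortF f α ++ stackSortF f β ++ [ maxL (x ∷ xs) ]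

-- the stack-sort operator S (fuel = length suffices, since α and β are shorter)
S : List ℕ → List ℕ
S π = stackSortF (length π) π

-- A mesh pattern (p; shaded R; marked M); p in one-line notation with values 1..k,
-- boxes (a , b) with a, b ∈ {0,...,k}.
record MeshPattern : Set where
  constructor mesh
  field
    pat    : List ℕ
    shaded : List (ℕ × ℕ)
    marked : List (ℕ × ℕ)
open MeshPattern public

ClassicalOcc : List ℕ → List ℕ → List ℕ → Set
ClassicalOcc p π is =
  (length is ≡ length p) ×
  (∀ a → a < length is → 1 ≤ nthD 0 is a × nthD 0 is a ≤ length π) ×
  (∀ a b → a < b → b < length is → nthD 0 is a < nthD 0 is b) ×
  (∀ a b → a < length p → b < length p →
     (val π (nthD 0 is a) < val π (nthD 0 is b)) ⇔ (nthD 0 p a < nthD 0 p b))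

-- i_a for a ∈ {0,...,k+1}, with i_0 = 0 and i_{k+1} = n+1
posE : List ℕ → List ℕ → ℕ → ℕ
posE π is = nthD (suc (length π)) (0 ∷ is ++ [ suc (length π) ])

-- v_b for b ∈ {0,...,k+1}: v_0 = 0, v_1 < ... < v_k the sorted occurrence values, v_{k+1} = n+1
valE : List ℕ → List ℕ → ℕ → ℕ
valE π is = nthD (suc (length π)) (0 ∷ sort (map (val π) is) ++ [ suc (length π) ])

InBox : List ℕ → List ℕ → ℕ × ℕ → ℕ → Set
InBox π is (a , b) t =
  (posE π is a < t) × (t < posE π is (suc a)) ×
  (valE π is b < val π t) × (val π t < valE π is (suc b))

-- marked condition: the union of the entries of the marked boxes is nonempty;
-- vacuous when there are no marked boxes (ordinary mesh pattern)
MarkedOK : List (ℕ × ℕ) → List ℕ → List ℕ → Set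
MarkedOK []         π is = ⊤
MarkedOK M@(_ ∷ _)  π is = Σ (ℕ × ℕ) λ box → box ∈ M × ∃ λ t → InBox π is box t

MeshOcc : MeshPattern → List ℕ → List ℕ → Set
MeshOcc P π is =
  ClassicalOcc (pat P) π is ×
  (∀ box → box ∈ shaded P → ∀ t → ¬ InBox π is box t) ×
  MarkedOK (marked P) π is

j₃ : MeshPattern
j₃ = mesh (4 ∷ 3 ∷ 2 ∷ 5 ∷ 1 ∷ []) ((1 , 4) ∷ (1 , 5) ∷ (2 , 4) ∷ (2 , 5) ∷ []) ((2 , 3) ∷ [])

W₂ : MeshPattern
W₂ = mesh (3 ∷ 2 ∷ 4 ∷ 1 ∷ []) ((1 , 4) ∷ []) []

module Submission where

-- Stack sorting outputs x before a later entry y exactly when some entry after x, up to and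
-- including y, exceeds x (keeps-order); otherwise y comes out first (swaps-order). For an occurrence d c b e a of j₃, the marked box
-- supplies an entry above c between c and b, so c precedes b in S(π); the shaded boxes make
-- every entry between d and b smaller than d, so b precedes d; and e between d and a makes d
-- precede a. For the shaded box of W₂: an entry v > d right of b is output after b, and an
-- entry v > d left of d either exceeds everything up to b (then it is output after b) or is
-- exceeded by some entry before d (then it is output before c).

open import Defs
open import Data.Nat using (ℕ; zero; suc; _+_; _<_; _≤_; _≟_; z≤n; s≤s; _<?_)
open import Data.Nat.Properties
open import Data.List using (List; []; _∷_; _++_; [_]; length; map; take; drop)
open import Data.List.Properties using (++-assoc; ∷-injective; length-++)
open import Data.List.Membership.Propositional using (_∈_; lose; find)
open import Data.List.Membership.Propositional.Properties
  using (∈-++⁺ˡ; ∈-++⁺ʳ; ∈-∃++; ∈-map⁻; ∈-upTo⁻)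
open import Data.List.Relation.Unary.Any using (Any; here; there)
open import Data.List.Relation.Unary.Any.Properties
  using () renaming (++⁺ˡ to any-++⁺ˡ; ++⁺ʳ to any-++⁺ʳ)
open import Data.List.Relation.Unary.All as All using (All; []; _∷_; lookup)
open import Data.List.Relation.Unary.All.Properties using (¬All⇒Any¬) renaming (++⁺ to all-++⁺)
open import Data.List.Relation.Unary.AllPairs using (AllPairs; []; _∷_)
open import Data.List.Relation.Unary.Linked using ([-]; _∷_)
open import Data.List.Relation.Unary.Linked.Properties using (Linked⇒AllPairs)
open import Data.List.Relation.Unary.Sorted.TotalOrder ≤-totalOrder using (Sorted)
open import Data.List.Relation.Unary.Sorted.TotalOrder.Properties using (↗↭↗⇒≋)
open import Data.List.Sort.InsertionSort ≤-decTotalOrder using (sort)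
open import Data.List.Sort.InsertionSort.Properties ≤-decTotalOrder using (sort-↭; sort-↗)
open import Data.List.Relation.Binary.Equality.Propositional using (≋⇒≡)
open import Data.List.Relation.Unary.Unique.Propositional using (Unique)
open import Data.List.Relation.Unary.Unique.Propositional.Properties using (map⁺; upTo⁺)
open import Data.List.Relation.Binary.Permutation.Setoid.Properties using (Unique-resp-↭)
open import Data.List.Relation.Binary.Permutation.Propositional
  using (_↭_; ↭-refl; ↭-sym; ↭-trans; ↭-prep; ↭-swap; ↭⇒↭ₛ)
open import Data.List.Relation.Binary.Permutation.Propositional.Properties
  using (++⁺; ++⁺ˡ; ∷↭∷ʳ; ∈-resp-↭; shift)
open import Data.Product using (Σ; ∃; ∃₂; _×_; _,_; proj₁; proj₂; map₂)
open import Data.Sum using (_⊎_; inj₁; inj₂)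
open import Data.Empty using (⊥-elim)
open import Function using (_∘_)
open import Function.Bundles using (_⇔_; mk⇔; Equivalence)
open import Relation.Nullary using (¬_; yes; no)
open import Relation.Nullary.Decidable using (True; toWitness)
open import Relation.Binary using (tri<; tri≈; tri>)
open import Relation.Binary.PropositionalEquality
  using (_≡_; refl; sym; trans; cong; subst; subst₂; setoid)

_‼_ : List ℕ → ℕ → ℕ
L ‼ i = nthD 0 L i

‼-∈ : ∀ L {i} → i < length L → L ‼ i ∈ L
‼-∈ (x ∷ L) {zero}  _         = here refl
‼-∈ (x ∷ L) {suc i} (s≤s i<n) = there (‼-∈ L i<n)

∈⇒index : ∀ {L z} → z ∈ L → ∃ λ i → i < length L × L ‼ i ≡ z
∈⇒index (here refl) = 0 , s≤s z≤n , refl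
∈⇒index (there z∈) with ∈⇒index z∈
... | i , i<n , e = suc i , s≤s i<n , e

All-‼ : ∀ {P : ℕ → Set} {L i} → All P L → i < length L → P (L ‼ i)
All-‼ {i = zero}  (p ∷ _)  _         = p
All-‼ {i = suc i} (_ ∷ ps) (s≤s i<n) = All-‼ ps i<n

AllPairs-‼ : ∀ {R : ℕ → ℕ → Set} {L i j} → AllPairs R L → i < j → j < length L →
  R (L ‼ i) (L ‼ j)
AllPairs-‼ {i = zero}  {suc j} (r ∷ _)  _         (s≤s j<n) = All-‼ r j<n
AllPairs-‼ {i = suc i} {suc j} (_ ∷ rs) (s≤s i<j) (s≤s j<n) = AllPairs-‼ rs i<j j<n

‼-injective : ∀ {L i j} → Unique L → i < length L → j < length L → L ‼ i ≡ L ‼ j → i ≡ j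
‼-injective {i = i} {j} u i<n j<n e with <-cmp i j
... | tri< i<j _ _ = ⊥-elim (AllPairs-‼ u i<j j<n e)
... | tri≈ _ i≡j _ = i≡j
... | tri> _ _ j<i = ⊥-elim (AllPairs-‼ u j<i i<n (sym e))

unique-resp-↭ : ∀ {xs ys : List ℕ} → xs ↭ ys → Unique xs → Unique ys
unique-resp-↭ xs↭ys = Unique-resp-↭ (setoid ℕ) (↭⇒↭ₛ xs↭ys)

perm-unique : ∀ {π} → IsPerm π → Unique π
perm-unique {π} perm = unique-resp-↭ (↭-sym perm) (map⁺ suc-injective (upTo⁺ (length π)))

perm-bound : ∀ {π z} → IsPerm π → z ∈ π → z ≤ length π
perm-bound perm z∈ with ∈-map⁻ suc (∈-resp-↭ perm z∈)
... | _ , k∈ , refl = ∈-upTo⁻ k∈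

sort-≡ : ∀ {xs ys} → Sorted ys → xs ↭ ys → sort xs ≡ ys
sort-≡ {xs} ys↗ xs↭ys =
  ≋⇒≡ (↗↭↗⇒≋ ≤-totalOrder (sort-↗ xs) ys↗ (↭⇒↭ₛ (↭-trans (sort-↭ xs) xs↭ys)))

lit< : ∀ {m n} {_ : True (m <? n)} → m < n
lit< {_} {_} {m<n} = toWitness m<n

data Segment (x : ℕ) (B : List ℕ) (y : ℕ) : List ℕ → Set where
  here  : ∀ {L C} → L ≡ B ++ y ∷ C → Segment x B y (x ∷ L)
  there : ∀ {w L} → Segment x B y L → Segment x B y (w ∷ L)

Precedes : ℕ → ℕ → List ℕ → Set
Precedes x y L = ∃ λ B → Segment x B y L

segment-++⁺ˡ : ∀ {x B y L} R → Segment x B y L → Segment x B y (L ++ R)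
segment-++⁺ˡ {B = B} {y} R (here {C = C} refl) = here (++-assoc B (y ∷ C) R)
segment-++⁺ˡ R (there s) = there (segment-++⁺ˡ R s)

segment-++⁺ʳ : ∀ {x B y L} P → Segment x B y L → Segment x B y (P ++ L)
segment-++⁺ʳ []      s = s
segment-++⁺ʳ (w ∷ P) s = there (segment-++⁺ʳ P s)

precedes-++ : ∀ {x y P Q} → x ∈ P → y ∈ Q → Precedes x y (P ++ Q)
precedes-++ {P = _ ∷ P} (here refl) y∈Q with ∈-∃++ y∈Q
... | Q₁ , Q₂ , refl = P ++ Q₁ , here (sym (++-assoc P Q₁ _))
precedes-++ (there x∈P) y∈Q = map₂ there (precedes-++ x∈P y∈Q)

segment-⊆ : ∀ {x B y L z} → Segment x B y L → z ∈ B ++ [ y ] → z ∈ L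
segment-⊆ {B = B} {y} (here {C = C} refl) z∈ =
  there (subst (_ ∈_) (++-assoc B [ y ] C) (∈-++⁺ˡ z∈))
segment-⊆ (there s) z∈ = there (segment-⊆ s z∈)

locate : ∀ α {m β} B {y C} → α ++ m ∷ β ≡ B ++ y ∷ C →
  (∃ λ (C′ : List ℕ) → α ≡ B ++ y ∷ C′) ⊎ y ≡ m ⊎ (m ∈ B × y ∈ β)
locate []      []      e with ∷-injective e
... | refl , _ = inj₂ (inj₁ refl)
locate []      (b ∷ B) e with ∷-injective e
... | refl , refl = inj₂ (inj₂ (here refl , ∈-++⁺ʳ B (here refl)))
locate (u ∷ α) []      e with ∷-injective e
... | refl , _ = inj₁ (α , refl)
locate (u ∷ α) (b ∷ B) e with ∷-injective e
... | refl , e′ with locate α B e′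
...   | inj₁ (C′ , refl)       = inj₁ (C′ , refl)
...   | inj₂ (inj₁ y≡m)        = inj₂ (inj₁ y≡m)
...   | inj₂ (inj₂ (m∈B , y∈β)) = inj₂ (inj₂ (there m∈B , y∈β))

data SegmentSplit (x : ℕ) (B : List ℕ) (y : ℕ) (α : List ℕ) (m : ℕ) (β : List ℕ) : Set where
  within-α : Segment x B y α → SegmentSplit x B y α m β
  within-β : Segment x B y β → SegmentSplit x B y α m β
  across-m : x ∈ α → m ∈ B → y ∈ β → SegmentSplit x B y α m β
  from-m   : x ≡ m → y ∈ β → SegmentSplit x B y α m β
  to-m     : x ∈ α → y ≡ m → SegmentSplit x B y α m β

split-segment : ∀ α {m β x B y} → Segment x B y (α ++ m ∷ β) → SegmentSplit x B y α m β
split-segment []      {B = B} (here refl) = from-m refl (∈-++⁺ʳ B (here refl))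
split-segment []      (there s) = within-β s
split-segment (u ∷ α) {B = B} (here e) with locate α B e
... | inj₁ (C′ , refl)        = within-α (here refl)
... | inj₂ (inj₁ y≡m)         = to-m (here refl) y≡m
... | inj₂ (inj₂ (m∈B , y∈β)) = across-m (here refl) m∈B y∈β
split-segment (u ∷ α) (there s) with split-segment α s
... | within-α s′          = within-α (there s′)
... | within-β s′          = within-β s′
... | across-m x∈α m∈B y∈β = across-m (there x∈α) m∈B y∈β
... | from-m x≡m y∈β       = from-m x≡m y∈β
... | to-m x∈α y≡m         = to-m (there x∈α) y≡m

segment-indices : ∀ {x B y L} → Segment x B y L →
  ∃₂ λ i j → i < j × j < length L × L ‼ i ≡ x × L ‼ j ≡ y
segment-indices {B = B} {y} (here {C = C} refl) =
  0 , suc (length B) , s≤s z≤n , s≤s (index<length B) , refl , index-of-y B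
  where
    index<length : ∀ B → length B < length (B ++ y ∷ C)
    index<length []      = s≤s z≤n
    index<length (_ ∷ B) = s≤s (index<length B)
    index-of-y : ∀ B → (B ++ y ∷ C) ‼ length B ≡ y
    index-of-y []      = refl
    index-of-y (_ ∷ B) = index-of-y B
segment-indices (there s) with segment-indices s
... | i , j , i<j , j<n , eᵢ , eⱼ = suc i , suc j , s≤s i<j , s≤s j<n , eᵢ , eⱼ

precedes⇒< : ∀ {L x y i j} → Unique L → Precedes x y L →
  i < length L → L ‼ i ≡ x → j < length L → L ‼ j ≡ y → i < j
precedes⇒< u (_ , s) i<n eᵢ j<n eⱼ with segment-indices s
... | i′ , j′ , i′<j′ , j′<n , eᵢ′ , eⱼ′ =
  subst₂ _<_ (‼-injective u (<-trans i′<j′ j′<n) i<n (trans eᵢ′ (sym eᵢ)))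
             (‼-injective u j′<n j<n (trans eⱼ′ (sym eⱼ))) i′<j′

data StackSorts : List ℕ → List ℕ → Set where
  []   : StackSorts [] []
  node : ∀ {α m β α′ β′} → All (_≤ m) (α ++ m ∷ β) → StackSorts α α′ → StackSorts β β′ →
         StackSorts (α ++ m ∷ β) (α′ ++ β′ ++ [ m ])

maxL-upper : ∀ L → All (_≤ maxL L) L
maxL-upper []      = []
maxL-upper (x ∷ L) =
  m≤m⊔n x (maxL L) ∷ All.map (λ z≤ → ≤-trans z≤ (m≤n⊔m x (maxL L))) (maxL-upper L)

maxL-∈ : ∀ x xs → maxL (x ∷ xs) ∈ x ∷ xs
maxL-∈ x []       = here (⊔-identityʳ x)
maxL-∈ x (y ∷ ys) with ⊔-sel x (maxL (y ∷ ys))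
... | inj₁ e = here e
... | inj₂ e = there (subst (_∈ y ∷ ys) (sym e) (maxL-∈ y ys))

splitAt-≡ : ∀ {m} L → m ∈ L → L ≡ proj₁ (splitAt m L) ++ m ∷ proj₂ (splitAt m L)
splitAt-≡ {m} (x ∷ xs) m∈ with x ≟ m | m∈
... | yes refl | _          = refl
... | no x≢m   | here m≡x   = ⊥-elim (x≢m (sym m≡x))
... | no _     | there m∈xs = cong (x ∷_) (splitAt-≡ xs m∈xs)

stackSortF-sorts : ∀ f L → length L ≤ f → StackSorts L (stackSortF f L)
stackSortF-sorts zero    []       _ = []
stackSortF-sorts (suc f) []       _ = []
stackSortF-sorts (suc f) (x ∷ xs) le =
  subst (λ L → StackSorts L (stackSortF (suc f) (x ∷ xs))) (sym L≡)
    (node (subst (All (_≤ m)) L≡ (maxL-upper (x ∷ xs)))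
          (stackSortF-sorts f α (≤-pred (≤-trans (m<m+n (length α) (s≤s z≤n)) fuel)))
          (stackSortF-sorts f β (≤-pred (≤-trans (m≤n+m (suc (length β)) _) fuel))))
  where
    m = maxL (x ∷ xs)
    α = proj₁ (splitAt m (x ∷ xs))
    β = proj₂ (splitAt m (x ∷ xs))
    L≡ : x ∷ xs ≡ α ++ m ∷ β
    L≡ = splitAt-≡ (x ∷ xs) (maxL-∈ x xs)
    fuel : length α + suc (length β) ≤ suc f
    fuel = subst (_≤ suc f) (trans (cong length L≡) (length-++ α)) le

S-sorts : ∀ π → StackSorts π (S π)
S-sorts π = stackSortF-sorts (length π) π ≤-refl

stackSorts-↭ : ∀ {L L′} → StackSorts L L′ → L′ ↭ L
stackSorts-↭ []                                   = ↭-refl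
stackSorts-↭ (node {α} {m} {β} _ sα sβ) =
  ↭-trans (++⁺ (stackSorts-↭ sα) (++⁺ (stackSorts-↭ sβ) ↭-refl))
          (++⁺ˡ α (↭-sym (∷↭∷ʳ m β)))

stackSorts-∈ : ∀ {L L′ z} → StackSorts L L′ → z ∈ L → z ∈ L′
stackSorts-∈ s = ∈-resp-↭ (↭-sym (stackSorts-↭ s))

keeps-order : ∀ {L L′ x B y} → StackSorts L L′ → Segment x B y L → Any (x <_) (B ++ [ y ]) →
  Precedes x y L′
keeps-order (node {α} {m} {β} {α′} {β′} bound sα sβ) seg larger with split-segment α seg
... | within-α s = map₂ (segment-++⁺ˡ (β′ ++ [ m ])) (keeps-order sα s larger)
... | within-β s = map₂ (segment-++⁺ʳ α′ ∘ segment-++⁺ˡ [ m ]) (keeps-order sβ s larger)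
... | across-m x∈α _ y∈β = precedes-++ (stackSorts-∈ sα x∈α) (∈-++⁺ˡ (stackSorts-∈ sβ y∈β))
... | to-m x∈α refl = precedes-++ (stackSorts-∈ sα x∈α) (∈-++⁺ʳ β′ (here refl))
... | from-m refl _ with find larger
...   | z , z∈ , m<z = ⊥-elim (<⇒≱ m<z (lookup bound (segment-⊆ seg z∈)))

swaps-order : ∀ {L L′ x B y} → StackSorts L L′ → Segment x B y L → All (_< x) (B ++ [ y ]) →
  Precedes y x L′
swaps-order {B = B} (node {α} {m} {β} {α′} {β′} bound sα sβ) seg smaller with split-segment α seg
... | within-α s = map₂ (segment-++⁺ˡ (β′ ++ [ m ])) (swaps-order sα s smaller)
... | within-β s = map₂ (segment-++⁺ʳ α′ ∘ segment-++⁺ˡ [ m ]) (swaps-order sβ s smaller)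
... | from-m refl y∈β = map₂ (segment-++⁺ʳ α′) (precedes-++ (stackSorts-∈ sβ y∈β) (here refl))
... | across-m x∈α m∈B _ =
  ⊥-elim (<⇒≱ (lookup smaller (∈-++⁺ˡ m∈B)) (lookup bound (∈-++⁺ˡ x∈α)))
... | to-m x∈α refl =
  ⊥-elim (<⇒≱ (lookup smaller (∈-++⁺ʳ B (here refl))) (lookup bound (∈-++⁺ˡ x∈α)))

take-‼-drop : ∀ L {q} → q < length L → L ≡ take q L ++ L ‼ q ∷ drop (suc q) L
take-‼-drop (x ∷ L) {zero}  _         = refl
take-‼-drop (x ∷ L) {suc q} (s≤s q<n) = cong (x ∷_) (take-‼-drop L q<n)

∈-take⇒index : ∀ L q {z} → z ∈ take q L → ∃ λ r → r < q × L ‼ r ≡ z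
∈-take⇒index (x ∷ L) (suc q) (here refl) = 0 , s≤s z≤n , refl
∈-take⇒index (x ∷ L) (suc q) (there z∈) with ∈-take⇒index L q z∈
... | r , r<q , e = suc r , s≤s r<q , e

index⇒∈-take : ∀ L {q r} → r < q → r < length L → L ‼ r ∈ take q L
index⇒∈-take (x ∷ L) {suc q} {zero}  _         _         = here refl
index⇒∈-take (x ∷ L) {suc q} {suc r} (s≤s r<q) (s≤s r<n) = there (index⇒∈-take L r<q r<n)

record Slice (L : List ℕ) (p q : ℕ) : Set where
  field
    inner   : List ℕ
    segment : Segment (L ‼ p) inner (L ‼ q) L
    inner-⊆ : ∀ {z} → z ∈ inner → ∃ λ r → p < r × r < q × L ‼ r ≡ z
    ⊆-inner : ∀ {r} → p < r → r < q → L ‼ r ∈ inner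

slice : ∀ L {p q} → p < q → q < length L → Slice L p q
slice (x ∷ L) {zero} {suc q} _ (s≤s q<n) = record
  { inner   = take q L
  ; segment = here (take-‼-drop L q<n)
  ; inner-⊆ = λ z∈ → let r , r<q , e = ∈-take⇒index L q z∈ in suc r , s≤s z≤n , s≤s r<q , e
  ; ⊆-inner = λ { {suc r} _ (s≤s r<q) → index⇒∈-take L r<q (<-trans r<q q<n) }
  }
slice (x ∷ L) {suc p} {suc q} (s≤s p<q) (s≤s q<n) = record
  { inner   = inner
  ; segment = there segment
  ; inner-⊆ = λ z∈ → let r , p<r , r<q , e = inner-⊆ z∈ in suc r , s≤s p<r , s≤s r<q , e
  ; ⊆-inner = λ { {suc r} (s≤s p<r) (s≤s r<q) → ⊆-inner p<r r<q }
  }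
  where open Slice (slice L p<q q<n)

keeps-order-at : ∀ {L L′ p q r} → StackSorts L L′ → p < r → r ≤ q → q < length L →
  L ‼ p < L ‼ r → Precedes (L ‼ p) (L ‼ q) L′
keeps-order-at {L} {p = p} {q} {r} sorts p<r r≤q q<n larger with m≤n⇒m<n∨m≡n r≤q
... | inj₁ r<q = keeps-order sorts segment (any-++⁺ˡ (lose (⊆-inner p<r r<q) larger))
  where open Slice (slice L (<-≤-trans p<r r≤q) q<n)
... | inj₂ refl = keeps-order sorts segment (any-++⁺ʳ inner (here larger))
  where open Slice (slice L p<r q<n)

both : ∀ {u v p q : ℕ} → u < v → p < q → (u < v) ⇔ (p < q)
both u<v p<q = mk⇔ (λ _ → p<q) (λ _ → u<v)

neither : ∀ {u v p q : ℕ} → v < u → q < p → (u < v) ⇔ (p < q)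
neither v<u q<p = mk⇔ (λ u<v → ⊥-elim (<-asym u<v v<u)) (λ p<q → ⊥-elim (<-asym p<q q<p))

diagonal : ∀ {u p : ℕ} → (u < u) ⇔ (p < p)
diagonal = mk⇔ (⊥-elim ∘ <-irrefl refl) (⊥-elim ∘ <-irrefl refl)

W₂-occurrence : ∀ M {i j k l} → i < j → j < k → k < l → l < length M →
  M ‼ l < M ‼ j → M ‼ j < M ‼ i → M ‼ i < M ‼ k →
  (∀ r → i < r → r < j → ¬ M ‼ k < M ‼ r) →
  MeshOcc W₂ M (suc i ∷ suc j ∷ suc k ∷ suc l ∷ [])
W₂-occurrence M {i} {j} {k} {l} i<j j<k k<l l<n a<b b<c c<d outside =
  (refl , (λ _ → All-‼ in-range) , (λ _ _ → AllPairs-‼ increasing) , order) , shading , _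
  where
    js = suc i ∷ suc j ∷ suc k ∷ suc l ∷ []
    a = M ‼ l
    b = M ‼ j
    c = M ‼ i
    d = M ‼ k
    k<n = <-trans k<l l<n
    j<n = <-trans j<k k<n

    in-range : All (λ t → 1 ≤ t × t ≤ length M) js
    in-range = (s≤s z≤n , <-trans i<j j<n) ∷ (s≤s z≤n , j<n) ∷ (s≤s z≤n , k<n) ∷
               (s≤s z≤n , l<n) ∷ []

    increasing : AllPairs _<_ js
    increasing = Linked⇒AllPairs <-trans (s≤s i<j ∷ s≤s j<k ∷ s≤s k<l ∷ [-])

    order : ∀ x y → x < 4 → y < 4 →
      (val M (js ‼ x) < val M (js ‼ y)) ⇔ (pat W₂ ‼ x < pat W₂ ‼ y)
    order 0 0 _ _ = diagonal
    order 0 1 _ _ = neither b<c lit<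
    order 0 2 _ _ = both c<d lit<
    order 0 3 _ _ = neither (<-trans a<b b<c) lit<
    order 1 0 _ _ = both b<c lit<
    order 1 1 _ _ = diagonal
    order 1 2 _ _ = both (<-trans b<c c<d) lit<
    order 1 3 _ _ = neither a<b lit<
    order 2 0 _ _ = neither c<d lit<
    order 2 1 _ _ = neither (<-trans b<c c<d) lit<
    order 2 2 _ _ = diagonal
    order 2 3 _ _ = neither (<-trans a<b (<-trans b<c c<d)) lit<
    order 3 0 _ _ = both (<-trans a<b b<c) lit<
    order 3 1 _ _ = both a<b lit<
    order 3 2 _ _ = both (<-trans a<b (<-trans b<c c<d)) lit<
    order 3 3 _ _ = diagonal
    order (suc (suc (suc (suc _)))) _ (s≤s (s≤s (s≤s (s≤s ())))) _
    order _ (suc (suc (suc (suc _)))) _ (s≤s (s≤s (s≤s (s≤s ()))))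

    values-sorted : sort (map (val M) js) ≡ a ∷ b ∷ c ∷ d ∷ []
    values-sorted = sort-≡ (<⇒≤ a<b ∷ <⇒≤ b<c ∷ <⇒≤ c<d ∷ [-])
      (↭-trans (shift a (c ∷ b ∷ d ∷ []) []) (↭-prep a (↭-swap c b ↭-refl)))

    shading : ∀ box → box ∈ shaded W₂ → ∀ t → ¬ InBox M js box t
    shading _ (here refl) zero    (() , _)
    shading _ (here refl) (suc r) (i<r , r<j , d<v , _) =
      outside r (≤-pred i<r) (≤-pred r<j)
        (subst (_< M ‼ r) (cong (λ ws → nthD _ (0 ∷ ws ++ _) 4) values-sorted) d<v)

W₂-from-precedences : ∀ {M a b c d} → Unique M →
  Precedes c b M → Precedes b d M → Precedes d a M → a < b → b < c → c < d →
  (∀ {v} → v ∈ M → d < v → Precedes v c M ⊎ Precedes b v M) →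
  Σ (List ℕ) λ js → MeshOcc W₂ M js × map (val M) js ↭ d ∷ c ∷ b ∷ a ∷ []
W₂-from-precedences {M} u c≺b b≺d d≺a a<b b<c c<d separated
  with segment-indices (proj₂ c≺b) | segment-indices (proj₂ d≺a)
... | i , j , i<j , j<n , refl , refl | k , l , k<l , l<n , refl , refl =
  suc i ∷ suc j ∷ suc k ∷ suc l ∷ [] ,
  W₂-occurrence M i<j j<k k<l l<n a<b b<c c<d outside ,
  shift (M ‼ k) (M ‼ i ∷ M ‼ j ∷ []) (M ‼ l ∷ [])
  where
    j<k = precedes⇒< u b≺d j<n refl (<-trans k<l l<n) refl
    outside : ∀ r → i < r → r < j → ¬ M ‼ k < M ‼ r
    outside r i<r r<j d<v with separated (‼-∈ M (<-trans r<j j<n)) d<v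
    ... | inj₁ v≺c = <-asym i<r (precedes⇒< u v≺c (<-trans r<j j<n) refl (<-trans i<j j<n) refl)
    ... | inj₂ b≺v = <-asym r<j (precedes⇒< u b≺v j<n refl (<-trans r<j j<n) refl)

-- An occurrence of j₃ at the 1-based positions suc q₁ < ... < suc q₅ of π, whose entries
-- d c b e a (with a < b < c < d < e) sit at the 0-based indices q₁ ... q₅.
record J₃Facts (π : List ℕ) (q₁ q₂ q₃ q₄ q₅ : ℕ) : Set where
  field
    q₁<q₂ : q₁ < q₂
    q₂<q₃ : q₂ < q₃
    q₃<q₄ : q₃ < q₄
    q₄<q₅ : q₄ < q₅
    q₅<n  : q₅ < length π
    a<b   : π ‼ q₅ < π ‼ q₃
    b<c   : π ‼ q₃ < π ‼ q₂
    c<d   : π ‼ q₂ < π ‼ q₁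
    d<e   : π ‼ q₁ < π ‼ q₄
    below-d        : ∀ r → q₁ < r → r < q₃ → π ‼ r < π ‼ q₁
    marked-above-c : ∃ λ r → q₂ < r × r < q₃ × π ‼ q₂ < π ‼ r

j₃-facts : ∀ {π q₁ q₂ q₃ q₄ q₅} → IsPerm π →
  MeshOcc j₃ π (suc q₁ ∷ suc q₂ ∷ suc q₃ ∷ suc q₄ ∷ suc q₅ ∷ []) →
  J₃Facts π q₁ q₂ q₃ q₄ q₅
j₃-facts {π} {q₁} {q₂} {q₃} {q₄} {q₅} perm
         ((_ , range , increasing , order) , empty , nonempty) = record
  { q₁<q₂ = q₁<q₂ ; q₂<q₃ = q₂<q₃ ; q₃<q₄ = q₃<q₄ ; q₄<q₅ = q₄<q₅
  ; q₅<n = q₅<n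
  ; a<b = a<b ; b<c = b<c ; c<d = c<d ; d<e = d<e
  ; below-d = below-d
  ; marked-above-c = marked-entry nonempty
  }
  where
    is = suc q₁ ∷ suc q₂ ∷ suc q₃ ∷ suc q₄ ∷ suc q₅ ∷ []
    n  = length π
    a = π ‼ q₅
    b = π ‼ q₃
    c = π ‼ q₂
    d = π ‼ q₁
    e = π ‼ q₄
    q₁<q₂ = ≤-pred (increasing 0 1 lit< lit<)
    q₂<q₃ = ≤-pred (increasing 1 2 lit< lit<)
    q₃<q₄ = ≤-pred (increasing 2 3 lit< lit<)
    q₄<q₅ = ≤-pred (increasing 3 4 lit< lit<)
    q₅<n = proj₂ (range 4 lit<)
    q₄<n = <-trans q₄<q₅ q₅<n
    q₁<n = <-trans q₁<q₂ (<-trans q₂<q₃ (<-trans q₃<q₄ q₄<n))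
    a<b = Equivalence.from (order 4 2 lit< lit<) lit<
    b<c = Equivalence.from (order 2 1 lit< lit<) lit<
    c<d = Equivalence.from (order 1 0 lit< lit<) lit<
    d<e = Equivalence.from (order 0 3 lit< lit<) lit<
    π-unique = perm-unique perm
    inside : ∀ {r} → r < q₃ → r < n
    inside r<q₃ = <-trans r<q₃ (<-trans q₃<q₄ q₄<n)

    values : ∀ k → valE π is k ≡ nthD (suc n) (0 ∷ a ∷ b ∷ c ∷ d ∷ e ∷ suc n ∷ []) k
    values k = cong (λ ws → nthD (suc n) (0 ∷ ws ++ [ suc n ]) k)
      (sort-≡ (<⇒≤ a<b ∷ <⇒≤ b<c ∷ <⇒≤ c<d ∷ <⇒≤ d<e ∷ [-])
        (↭-trans (shift a (d ∷ c ∷ b ∷ e ∷ []) [])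
          (↭-prep a (↭-trans (shift b (d ∷ c ∷ []) (e ∷ [])) (↭-prep b (↭-swap d c ↭-refl))))))

    -- An entry of column k above d would lie in box (k , 4) or (k , 5), or be d or e itself.
    column-below-d : ∀ {k r} → (k , 4) ∈ shaded j₃ → (k , 5) ∈ shaded j₃ →
      posE π is k < suc r → suc r < posE π is (suc k) → q₁ < r → r < q₃ → π ‼ r < d
    column-below-d {k} {r} box₄ box₅ after before q₁<r r<q₃ with <-cmp (π ‼ r) d | <-cmp (π ‼ r) e
    ... | tri< v<d _ _ | _ = v<d
    ... | tri≈ _ v≡d _ | _ =
      ⊥-elim (<-irrefl (‼-injective π-unique q₁<n (inside r<q₃) (sym v≡d)) q₁<r)
    ... | tri> _ _ d<v | tri< v<e _ _ = ⊥-elim (empty (k , 4) box₄ (suc r)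
      (after , before , subst (_< π ‼ r) (sym (values 4)) d<v , subst (π ‼ r <_) (sym (values 5)) v<e))
    ... | tri> _ _ _   | tri≈ _ v≡e _ =
      ⊥-elim (<-irrefl (‼-injective π-unique (inside r<q₃) q₄<n v≡e) (<-trans r<q₃ q₃<q₄))
    ... | tri> _ _ _   | tri> _ _ e<v = ⊥-elim (empty (k , 5) box₅ (suc r)
      (after , before , subst (_< π ‼ r) (sym (values 5)) e<v ,
       subst (π ‼ r <_) (sym (values 6)) (s≤s (perm-bound perm (‼-∈ π (inside r<q₃))))))

    below-d : ∀ r → q₁ < r → r < q₃ → π ‼ r < d
    below-d r q₁<r r<q₃ with <-cmp r q₂
    ... | tri< r<q₂ _ _ =
      column-below-d (here refl) (there (here refl)) (s≤s q₁<r) (s≤s r<q₂) q₁<r r<q₃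
    ... | tri≈ _ refl _ = c<d
    ... | tri> _ _ q₂<r =
      column-below-d (there (there (here refl))) (there (there (there (here refl))))
        (s≤s q₂<r) (s≤s r<q₃) q₁<r r<q₃

    marked-entry : MarkedOK (marked j₃) π is → ∃ λ r → q₂ < r × r < q₃ × c < π ‼ r
    marked-entry (_ , here refl , zero  , () , _)
    marked-entry (_ , here refl , suc r , after , before , c<v , _) =
      r , ≤-pred after , ≤-pred before , subst (_< π ‼ r) (values 3) c<v

module SortedImage {π q₁ q₂ q₃ q₄ q₅} (π-unique : Unique π) (F : J₃Facts π q₁ q₂ q₃ q₄ q₅)
  where
  open J₃Facts F
  private
    sorts = S-sorts π
    a = π ‼ q₅
    b = π ‼ q₃
    c = π ‼ q₂
    d = π ‼ q₁
    q₄<n = <-trans q₄<q₅ q₅<n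
    q₃<n = <-trans q₃<q₄ q₄<n
    q₂<n = <-trans q₂<q₃ q₃<n
    b<d = <-trans b<c c<d

  c≺b : Precedes c b (S π)
  c≺b = let r , q₂<r , r<q₃ , c<v = marked-above-c in keeps-order-at sorts q₂<r (<⇒≤ r<q₃) q₃<n c<v

  d≺a : Precedes d a (S π)
  d≺a = keeps-order-at sorts (<-trans q₁<q₂ (<-trans q₂<q₃ q₃<q₄)) (<⇒≤ q₄<q₅) q₅<n d<e

  b≺d : Precedes b d (S π)
  b≺d = swaps-order sorts segment (all-++⁺ (All.tabulate below) (b<d ∷ []))
    where
      open Slice (slice π (<-trans q₁<q₂ q₂<q₃) q₃<n)
      below : ∀ {z} → z ∈ inner → z < d
      below z∈ = let r , q₁<r , r<q₃ , e = inner-⊆ z∈ in subst (_< d) e (below-d r q₁<r r<q₃)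

  module _ {s} (s<q₁ : s < q₁) where
    open Slice (slice π (<-trans s<q₁ (<-trans q₁<q₂ q₂<q₃)) q₃<n)

    left-of-d : d < π ‼ s → Precedes (π ‼ s) c (S π) ⊎ Precedes b (π ‼ s) (S π)
    left-of-d d<v with All.all? (_<? π ‼ s) inner
    ... | yes smaller = inj₂ (swaps-order sorts segment (all-++⁺ smaller (<-trans b<d d<v ∷ [])))
    ... | no ¬smaller with find (¬All⇒Any¬ (_<? π ‼ s) inner ¬smaller)
    ...   | z , z∈ , v≮z with inner-⊆ z∈
    ...     | r , s<r , r<q₃ , refl with <-cmp r q₁
    ...       | tri≈ _ refl _ = ⊥-elim (v≮z d<v)
    ...       | tri> _ _ q₁<r = ⊥-elim (v≮z (<-trans (below-d r q₁<r r<q₃) d<v))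
    ...       | tri< r<q₁ _ _ = inj₁ (keeps-order-at sorts s<r (<⇒≤ (<-trans r<q₁ q₁<q₂)) q₂<n v<z)
      where
        r<n = <-trans r<q₁ (<-trans q₁<q₂ q₂<n)
        v<z = ≤∧≢⇒< (≮⇒≥ v≮z)
                    (λ e → <-irrefl (‼-injective π-unique (<-trans s<r r<n) r<n e) s<r)

  large-separated : ∀ {v} → v ∈ π → d < v → Precedes v c (S π) ⊎ Precedes b v (S π)
  large-separated v∈ d<v with ∈⇒index v∈
  ... | s , s<n , refl with <-cmp s q₁ | <-cmp s q₃
  ...   | tri< s<q₁ _ _ | _            = left-of-d s<q₁ d<v
  ...   | tri≈ _ refl _ | _            = ⊥-elim (<-irrefl refl d<v)
  ...   | tri> _ _ q₁<s | tri< s<q₃ _ _ = ⊥-elim (<-asym d<v (below-d s q₁<s s<q₃))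
  ...   | tri> _ _ _    | tri≈ _ refl _ = ⊥-elim (<-asym d<v b<d)
  ...   | tri> _ _ _    | tri> _ _ q₃<s = inj₂ (keeps-order-at sorts q₃<s ≤-refl s<n (<-trans b<d d<v))

data FivePositions : List ℕ → Set where
  positions : ∀ {q₁ q₂ q₃ q₄ q₅} →
              FivePositions (suc q₁ ∷ suc q₂ ∷ suc q₃ ∷ suc q₄ ∷ suc q₅ ∷ [])

five-positions : ∀ {π is} → ClassicalOcc (pat j₃) π is → FivePositions is
five-positions {is = []}                          (() , _)
five-positions {is = _ ∷ []}                      (() , _)
five-positions {is = _ ∷ _ ∷ []}                  (() , _)
five-positions {is = _ ∷ _ ∷ _ ∷ []}              (() , _)
five-positions {is = _ ∷ _ ∷ _ ∷ _ ∷ []}          (() , _)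
five-positions {is = _ ∷ _ ∷ _ ∷ _ ∷ _ ∷ _ ∷ _}  (() , _)
five-positions {is = _ ∷ _ ∷ _ ∷ _ ∷ _ ∷ []} (refl , range , _) =
  positive (proj₁ (range 0 lit<)) (proj₁ (range 1 lit<)) (proj₁ (range 2 lit<))
           (proj₁ (range 3 lit<)) (proj₁ (range 4 lit<))
  where
    positive : ∀ {i₁ i₂ i₃ i₄ i₅} → 1 ≤ i₁ → 1 ≤ i₂ → 1 ≤ i₃ → 1 ≤ i₄ → 1 ≤ i₅ →
      FivePositions (i₁ ∷ i₂ ∷ i₃ ∷ i₄ ∷ i₅ ∷ [])
    positive (s≤s _) (s≤s _) (s≤s _) (s≤s _) (s≤s _) = positions

lemma3p3 : (π : List ℕ) → IsPerm π → (is : List ℕ) → MeshOcc j₃ π is →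
    Σ (List ℕ) λ js → MeshOcc W₂ (S π) js ×
      (map (val (S π)) js ↭
        (val π (nthD 0 is 0) ∷ val π (nthD 0 is 1) ∷ val π (nthD 0 is 2) ∷ val π (nthD 0 is 4) ∷ []))
lemma3p3 π perm is occ with five-positions {π} {is} (proj₁ occ)
... | positions =
  W₂-from-precedences (unique-resp-↭ (↭-sym S-↭) π-unique)
    c≺b b≺d d≺a a<b b<c c<d (large-separated ∘ ∈-resp-↭ S-↭)
  where
    S-↭ = stackSorts-↭ (S-sorts π)
    π-unique = perm-unique perm
    facts = j₃-facts perm occ
    open J₃Facts facts
    open SortedImage π-unique facts
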